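{- Let $\Gamma$ be a geometric distance-regular graph with respect to $\mathcal C$, having valency $k$, smallest eigenvalue $\theta_{\min}$, diameter $D \geq 3$, and $\phi_1 \geq 2$. Let $r = -\theta_{\min}$ and $\beta = \frac{k}{ -\theta_{\min}}$. Assume that $\Gamma$ satisfies the dual Pasch axiom. Let $\ell\in\mathcal{C}$ be a line, $M$ an assembly and $u$ a vertex of $\Gamma$ not in $M$. Then: (1) If $\ell$ and $M$ have a common vertex, then $|\ell\cap M|=\phi_1$. (2) If $u$ has a neighbour in $M$, then $u$ has exactly $\phi_1$ neighbours in $M$ and there is exactly one line through $u$ that intersects $M$. Consequently, for each vertex $x$ of $\Gamma$, the local graph $\Delta_x$ is the $(\phi_1-1)$-clique extension of a $\frac{\beta}{\phi_1-1} \times r$-grid.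
   Context: A connected graph $\Gamma$ of diameter $D$ is distance-regular if there are integers $b_i, c_i$ such that for all vertices $x,y$ at distance $i$, $y$ has exactly $c_i$ neighbours at distance $i-1$ from $x$ and $b_i$ neighbours at distance $i+1$ from $x$; $k=b_0$. A Delsarte clique is a clique with exactly $1+k/(-\theta_{\min})$ vertices. $\Gamma$ is geometric with respect to $\mathcal{C}$ if $\mathcal{C}$ is a set of Delsarte cliques (lines) with each edge in exactly one line. $\phi_1$ is the number of vertices of a Delsarte clique $C$ adjacent to a vertex at distance $1$ from $C$ (independent of choices). $\Gamma$ satisfies the dual Pasch axiom if for every pair of adjacent vertices $x,y$, the set of common neighbours of $x$ and $y$ not lying on the line through $x$ and $y$ is a clique. An assembly is a maximal clique of $\Gamma$ not in $\mathcal{C}$. The local graph $\Delta_x$ is the subgraph induced on the neighbours of $x$. The $m\times n$-grid is $K_m\Box K_n$. The $s$-clique extension of a graph $G$ replaces each vertex $x$ by a clique $\tilde X$ of $s$ vertices, with $u\in\tilde X$, $v\in\tilde Y$ ($\tilde X\ne\tilde Y$) adjacent iff $x\sim y$ in $G$. -}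

module Defs where

open import Data.Nat as ℕ using (ℕ; zero; suc; _∸_; _≥_)
open import Data.Bool using (Bool; true; false; T; _∧_; _∨_; not; if_then_else_)
open import Data.Fin using (Fin; zero; suc)
open import Data.Fin.Subset using (Subset; _∈_; _∉_; _∩_; ∣_∣)
open import Data.Fin.Subset.Properties using (_∈?_)
open import Data.Integer using (+_)
open import Data.Rational using (ℚ; 0ℚ; _/_; _+_; _*_; -_; _≤_)
open import Data.Product using (Σ; ∃; ∃-syntax; _×_; _,_; proj₁; proj₂)
open import Relation.Nullary using (¬_; does)
open import Relation.Binary.PropositionalEquality using (_≡_; _≢_)

count : {n : ℕ} → (Fin n → Bool) → ℕ
count {zero}  p = 0
count {suc n} p = (if p zero then 1 else 0) ℕ.+ count (λ i → p (suc i))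

anyF : {n : ℕ} → (Fin n → Bool) → Bool
anyF {zero}  p = false
anyF {suc n} p = p zero ∨ anyF (λ i → p (suc i))

sumℚ : {n : ℕ} → (Fin n → ℚ) → ℚ
sumℚ {zero}  f = 0ℚ
sumℚ {suc n} f = f zero + sumℚ (λ i → f (suc i))

ℕ→ℚ : ℕ → ℚ
ℕ→ℚ m = (+ m) / 1

mem : {n : ℕ} → Fin n → Subset n → Bool
mem x S = does (x ∈? S)

record IsSimpleGraph {n : ℕ} (A : Fin n → Fin n → Bool) : Set where
  field
    symmetric   : ∀ x y → A x y ≡ A y x
    irreflexive : ∀ x → A x x ≡ false

module _ {n : ℕ} (A : Fin n → Fin n → Bool) where

  within : ℕ → Fin n → Fin n → Bool
  within zero    x y = does (x Data.Fin.≟ y)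
  within (suc i) x y = within i x y ∨ anyF (λ z → A x z ∧ within i z y)

  dist≡ : Fin n → Fin n → ℕ → Bool
  dist≡ x y zero    = within zero x y
  dist≡ x y (suc i) = within (suc i) x y ∧ not (within i x y)

  degree : Fin n → ℕ
  degree x = count (λ y → A x y)

  HasDiameter : ℕ → Set
  HasDiameter D = (∀ x y → T (within D x y))
                × ∃[ x ] ∃[ y ] T (dist≡ x y D)

  IsDRG : ℕ → ℕ → Set
  IsDRG k D =
      IsSimpleGraph A
    × HasDiameter D
    × (∀ x → degree x ≡ k)
    × Σ (ℕ → ℕ) λ b → Σ (ℕ → ℕ) λ c →
        (b 0 ≡ k)
      × (∀ x y i → T (dist≡ x y i) →
            (count (λ z → A y z ∧ dist≡ x z (i ∸ 1)) ≡ c i)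
          × (count (λ z → A y z ∧ dist≡ x z (suc i)) ≡ b i))

  Aℚ : Fin n → Fin n → ℚ
  Aℚ x y = if A x y then ℕ→ℚ 1 else 0ℚ

  applyA : (Fin n → ℚ) → Fin n → ℚ
  applyA v x = sumℚ (λ y → Aℚ x y * v y)

  -- θ is the smallest eigenvalue of the (real symmetric) adjacency
  -- matrix: θ is an eigenvalue, and A - θ I is positive semidefinite.
  IsSmallestEigenvalue : ℚ → Set
  IsSmallestEigenvalue θ =
      (∃[ v ] (∃[ x ] v x ≢ 0ℚ) × (∀ x → applyA v x ≡ θ * v x))
    × (∀ (w : Fin n → ℚ) →
         θ * sumℚ (λ x → w x * w x) ≤ sumℚ (λ x → w x * applyA w x))

  IsClique : Subset n → Set
  IsClique C = ∀ x y → x ∈ C → y ∈ C → x ≢ y → T (A x y)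

  -- Delsarte clique: a clique with exactly 1 + k/(-θ) vertices,
  -- written multiplicatively as (|C| - 1)·(-θ) = k
  IsDelsarte : ℕ → ℚ → Subset n → Set
  IsDelsarte k θ C = IsClique C × (ℕ→ℚ (∣ C ∣ ∸ 1) * (- θ) ≡ ℕ→ℚ k)
                     × (∣ C ∣ ≥ 1)

  IsGeometric : ℕ → ℚ → (Subset n → Set) → Set
  IsGeometric k θ 𝒞 =
      (∀ C → 𝒞 C → IsDelsarte k θ C)
    × (∀ x y → T (A x y) →
         (∃[ ℓ ] 𝒞 ℓ × x ∈ ℓ × y ∈ ℓ)
       × (∀ ℓ ℓ′ → 𝒞 ℓ → x ∈ ℓ → y ∈ ℓ → 𝒞 ℓ′ → x ∈ ℓ′ → y ∈ ℓ′ → ℓ ≡ ℓ′))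

  nbrsIn : Fin n → Subset n → ℕ
  nbrsIn u S = count (λ z → A u z ∧ mem z S)

  AtDist1 : Fin n → Subset n → Set
  AtDist1 u S = u ∉ S × ∃[ z ] (z ∈ S × T (A u z))

  IsPhi1 : ℕ → ℚ → ℕ → Set
  IsPhi1 k θ φ₁ = ∀ C x → IsDelsarte k θ C → AtDist1 x C → nbrsIn x C ≡ φ₁

  DualPasch : (Subset n → Set) → Set
  DualPasch 𝒞 = ∀ x y ℓ → T (A x y) → 𝒞 ℓ → x ∈ ℓ → y ∈ ℓ →
    ∀ z w → T (A x z) → T (A y z) → T (A x w) → T (A y w) →
    z ∉ ℓ → w ∉ ℓ → z ≢ w → T (A z w)

  IsMaximalClique : Subset n → Set
  IsMaximalClique M = IsClique M × (∀ v → v ∉ M → ¬ (∀ z → z ∈ M → T (A v z)))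

  IsAssembly : (Subset n → Set) → Subset n → Set
  IsAssembly 𝒞 M = IsMaximalClique M × ¬ 𝒞 M

record Graph : Set₁ where
  field
    V   : Set
    Adj : V → V → Set

open Graph

record _≅_ (G H : Graph) : Set where
  field
    to      : V G → V H
    from    : V H → V G
    from∘to : ∀ a → from (to a) ≡ a
    to∘from : ∀ b → to (from b) ≡ b
    adj-to   : ∀ a b → Adj G a b → Adj H (to a) (to b)
    adj-from : ∀ a b → Adj H (to a) (to b) → Adj G a b

Local : {n : ℕ} → (Fin n → Fin n → Bool) → Fin n → Graph
Local {n} A x = record
  { V   = Σ (Fin n) (λ y → T (A x y))
  ; Adj = λ p q → T (A (proj₁ p) (proj₁ q)) }

Grid : ℕ → ℕ → Graph
Grid m r = record
  { V   = Fin m × Fin r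
  ; Adj = λ p q → (proj₁ p ≡ proj₁ q × proj₂ p ≢ proj₂ q)
                Data.Sum.⊎ (proj₂ p ≡ proj₂ q × proj₁ p ≢ proj₁ q) }
  where import Data.Sum

CliqueExt : ℕ → Graph → Graph
CliqueExt s G = record
  { V   = V G × Fin s
  ; Adj = λ p q → (proj₁ p ≡ proj₁ q × proj₂ p ≢ proj₂ q)
                Data.Sum.⊎ (proj₁ p ≢ proj₁ q × Adj G (proj₁ p) (proj₁ q)) }
  where import Data.Sum

{-# OPTIONS --safe #-}

-- If a vertex a outside an assembly M has two
-- neighbours x, b in M with b off the line xa, the dual Pasch axiom makes a adjacent
-- to all of M, against maximality.  So a vertex outside M sees M along a single line;
-- counting the φ₁ neighbours on a line ℓ of a vertex of M outside ℓ gives (1), and (2)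
-- follows.
--
-- In the local graph at x, two neighbours of x are in the same row when they lie on
-- one line through x.  The dual Pasch axiom makes the relation "same column" below an
-- equivalence, and each row meets each column in φ₁ - 1 vertices: those neighbours,
-- other than x, of a suitable vertex off the row that lie on its line.  Enumerating
-- rows, columns and cells identifies Δₓ with the clique extension of a grid, and
-- comparing k = #rows · (|line| - 1) with the Delsarte size (|line| - 1)(-θ) = k
-- gives #rows = -θ.

module Submission where

open import Defs
open import Data.Bool using (Bool; true; false; T; _∧_; not; if_then_else_)
import Data.Bool.Properties as Bool
open import Data.Bool.Properties using (T-∧; T-∨; T-not-≡; T-irrelevant)
open import Data.Empty using (⊥; ⊥-elim)
open import Data.Fin using (Fin; zero; suc; _≟_; fromℕ<)
open import Data.Fin.Permutation using (↔⇒≡)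
open import Data.Fin.Properties using (0↔⊥; 1↔⊤; +↔⊎; *↔×; toℕ<n; any?)
open import Data.Fin.Subset using (Subset; _∈_; _∉_; _∩_; ∣_∣) renaming (⊥ to ∅)
open import Data.Fin.Subset.Properties using (_∈?_; ⊆-antisym; x∈p∩q⁺; x∈p∩q⁻)
open import Data.Integer using (+_)
import Data.Integer.Properties as ℤ
open import Data.Maybe using (Maybe; just; nothing; fromMaybe)
import Data.Maybe as Maybe
open import Data.Nat using (ℕ; zero; suc; _≤_; _<_; _≥_; _∸_; _*_; z≤n; s≤s)
import Data.Nat.Coprimality as Coprime
open import Data.Nat.Properties
  using (m≤n⇒m≤1+n; <-irrefl; <-≤-trans; ≤-antisym; suc-injective; m<n⇒0<n∸m; m<n⇒n≢0;
         *-identityˡ; <⇒≤; *-commutativeSemigroup; module ≤-Reasoning)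
open import Algebra.Properties.CommutativeSemigroup *-commutativeSemigroup using (xy∙z≈xz∙y)
open import Data.Product using (Σ; ∃-syntax; _×_; _,_; proj₁; proj₂)
open import Data.Product.Function.NonDependent.Propositional using (_×-↔_)
open import Data.Rational using (ℚ; 0ℚ; 1ℚ; -_)
import Data.Rational as ℚ
import Data.Rational.Properties as ℚ
open import Data.Sum using (_⊎_; inj₁; inj₂; [_,_]′)
open import Data.Sum.Function.Propositional using (_⊎-↔_)
open import Data.Unit using (⊤; tt)
open import Data.Vec using (_∷_; [])
open import Data.Vec.Properties using (≡-dec)
open import Function using (_∘_; _∘′_; _on_)
open import Function.Bundles using (_↔_; Inverse; Equivalence; mk↔ₛ′)
open import Function.Properties.Inverse using (↔-refl; ↔-sym; ↔-trans)
open import Level using (Level)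
open import Relation.Binary using (Rel; Decidable; IsEquivalence)
open import Relation.Nullary using (¬_; Dec; does; yes; no; contradiction; _×-dec_; _⊎-dec_; ¬?)
open import Relation.Nullary.Decidable using (T?; decidable-stable)
open import Relation.Unary using (_⊆_)
open import Relation.Binary.PropositionalEquality

private variable
  n : ℕ

does⇒ : ∀ {p} {P : Set p} (p? : Dec P) → T (does p?) → P
does⇒ (yes a) _ = a

⇒does : ∀ {p} {P : Set p} (p? : Dec P) → P → T (does p?)
⇒does (yes _)  _ = _
⇒does (no ¬a) a = ¬a a

Member : (Fin n → Bool) → Set
Member {n} P = Σ (Fin n) (T ∘ P)

Member-≡ : {P : Fin n → Bool} {y y′ : Fin n} {p : T (P y)} {p′ : T (P y′)} →
           y ≡ y′ → _≡_ {A = Member P} (y , p) (y′ , p′)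
Member-≡ {p = p} {p′} refl = cong (_ ,_) (T-irrelevant p p′)

private
  Fin-if↔T : ∀ b → Fin (if b then 1 else 0) ↔ T b
  Fin-if↔T true  = 1↔⊤
  Fin-if↔T false = 0↔⊥

  Member-suc↔ : (P : Fin (suc n) → Bool) → (T (P zero) ⊎ Member (P ∘ suc)) ↔ Member P
  Member-suc↔ P = mk↔ₛ′ to from (λ { (zero , _) → refl ; (suc _ , _) → refl })
                                 (λ { (inj₁ _) → refl ; (inj₂ _) → refl })
    where
    to : T (P zero) ⊎ Member (P ∘ suc) → Member P
    to (inj₁ p)       = zero , p
    to (inj₂ (i , p)) = suc i , p
    from : Member P → T (P zero) ⊎ Member (P ∘ suc)
    from (zero  , p) = inj₁ p
    from (suc i , p) = inj₂ (i , p)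

opaque
  enumeration : (P : Fin n → Bool) → Fin (count P) ↔ Member P
  enumeration {zero}  P = mk↔ₛ′ (λ ()) (λ ()) (λ ()) (λ ())
  enumeration {suc n} P =
    ↔-trans +↔⊎ (↔-trans (Fin-if↔T (P zero) ⊎-↔ enumeration (P ∘ suc)) (Member-suc↔ P))

count-mono : (P Q : Fin n → Bool) → T ∘ P ⊆ T ∘ Q → count P ≤ count Q
count-mono {zero}  P Q P⊆Q = z≤n
count-mono {suc n} P Q P⊆Q with P zero in eP | Q zero in eQ
... | true  | true  = s≤s (count-mono (P ∘ suc) (Q ∘ suc) P⊆Q)
... | false | false = count-mono (P ∘ suc) (Q ∘ suc) P⊆Q
... | false | true  = m≤n⇒m≤1+n (count-mono (P ∘ suc) (Q ∘ suc) P⊆Q)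
... | true  | false = ⊥-elim (subst T eQ (P⊆Q (subst T (sym eP) _)))

count-cong : (P Q : Fin n → Bool) → T ∘ P ⊆ T ∘ Q → T ∘ Q ⊆ T ∘ P → count P ≡ count Q
count-cong P Q P⊆Q Q⊆P = ≤-antisym (count-mono P Q P⊆Q) (count-mono Q P Q⊆P)

count-mono-< : (P Q : Fin n → Bool) → T ∘ P ⊆ T ∘ Q →
               ∀ j → T (Q j) → ¬ T (P j) → count P < count Q
count-mono-< {suc n} P Q P⊆Q j qj ¬pj with P zero in eP | Q zero in eQ | j
... | true  | false | _     = ⊥-elim (subst T eQ (P⊆Q (subst T (sym eP) _)))
... | true  | _     | zero  = ⊥-elim (¬pj (subst T (sym eP) _))
... | false | false | zero  = ⊥-elim (subst T eQ qj)
... | false | true  | zero  = s≤s (count-mono (P ∘ suc) (Q ∘ suc) P⊆Q)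
... | true  | true  | suc j = s≤s (count-mono-< (P ∘ suc) (Q ∘ suc) P⊆Q j qj ¬pj)
... | false | false | suc j = count-mono-< (P ∘ suc) (Q ∘ suc) P⊆Q j qj ¬pj
... | false | true  | suc j = m≤n⇒m≤1+n (count-mono-< (P ∘ suc) (Q ∘ suc) P⊆Q j qj ¬pj)

⊆∧count≥⇒⊇ : (P Q : Fin n → Bool) → T ∘ P ⊆ T ∘ Q → count Q ≤ count P → T ∘ Q ⊆ T ∘ P
⊆∧count≥⇒⊇ P Q P⊆Q Q≤P {j} qj with T? (P j)
... | yes pj = pj
... | no ¬pj = contradiction (<-≤-trans (count-mono-< P Q P⊆Q j qj ¬pj) Q≤P) (<-irrefl refl)

_∖_ : (Fin n → Bool) → Fin n → Fin n → Bool
(P ∖ x) i = not (does (i ≟ x)) ∧ P i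

count-remove : (P : Fin n → Bool) (x : Fin n) → T (P x) → count P ≡ suc (count (P ∖ x))
count-remove {suc n} P zero    px with P zero
... | true = refl
count-remove {suc n} P (suc x) px with P zero
... | true  = cong suc (count-remove (P ∘ suc) x px)
... | false = count-remove (P ∘ suc) x px

∖-intro : (P : Fin n → Bool) (x : Fin n) {i : Fin n} → i ≢ x → T (P i) → T ((P ∖ x) i)
∖-intro P x {i} i≢x pi with i ≟ x
... | yes i≡x = i≢x i≡x
... | no _    = pi

∖-≢ : (P : Fin n → Bool) (x : Fin n) {i : Fin n} → T ((P ∖ x) i) → i ≢ x
∖-≢ P x {i} h with i ≟ x
... | no i≢x = i≢x

∖-⊆ : (P : Fin n → Bool) (x : Fin n) {i : Fin n} → T ((P ∖ x) i) → T (P i)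
∖-⊆ P x {i} h with i ≟ x
... | no _ = h

count>0⇒Member : (P : Fin n → Bool) → 0 < count P → Member P
count>0⇒Member P 0<count = Inverse.to (enumeration P) (fromℕ< 0<count)

Member⇒count>0 : (P : Fin n → Bool) → Member P → 0 < count P
Member⇒count>0 P y = <-≤-trans (s≤s z≤n) (toℕ<n (Inverse.from (enumeration P) y))

∣∣≡count : (S : Subset n) → ∣ S ∣ ≡ count (λ i → mem i S)
∣∣≡count []          = refl
∣∣≡count (true ∷ S)  = cong suc (∣∣≡count S)
∣∣≡count (false ∷ S) = ∣∣≡count S

count-∖ : (P : Fin n → Bool) (x : Fin n) → T (P x) → count (P ∖ x) ≡ count P ∸ 1
count-∖ P x px = cong (_∸ 1) (sym (count-remove P x px))

ℕ→ℚ≡mkℚ : ∀ m → ℕ→ℚ m ≡ ℚ.mkℚ (+ m) 0 (Coprime.sym (Coprime.1-coprimeTo m))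
ℕ→ℚ≡mkℚ m = ℚ.normalize-coprime (Coprime.sym (Coprime.1-coprimeTo m))

ℕ→ℚ-* : ∀ m n → ℕ→ℚ (m * n) ≡ ℕ→ℚ m ℚ.* ℕ→ℚ n
ℕ→ℚ-* m n rewrite ℕ→ℚ≡mkℚ m | ℕ→ℚ≡mkℚ n = cong (ℚ._/ 1) (ℤ.pos-* m n)

ℕ→ℚ-injective : ∀ {m n} → ℕ→ℚ m ≡ ℕ→ℚ n → m ≡ n
ℕ→ℚ-injective {m} {n} eq = ℤ.+-injective (cong ℚ.↥_ (trans (sym (ℕ→ℚ≡mkℚ m)) (trans eq (ℕ→ℚ≡mkℚ n))))

*-cancelʳ-≡ : ∀ {p q} r → r ≢ 0ℚ → p ℚ.* r ≡ q ℚ.* r → p ≡ q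
*-cancelʳ-≡ {p} {q} r r≢0 pr≡qr = begin
  p                      ≡⟨ sym (ℚ.*-identityʳ p) ⟩
  p ℚ.* 1ℚ               ≡⟨ cong (p ℚ.*_) (sym (ℚ.*-inverseʳ r)) ⟩
  p ℚ.* (r ℚ.* r⁻¹)      ≡⟨ sym (ℚ.*-assoc p r r⁻¹) ⟩
  (p ℚ.* r) ℚ.* r⁻¹      ≡⟨ cong (ℚ._* r⁻¹) pr≡qr ⟩
  (q ℚ.* r) ℚ.* r⁻¹      ≡⟨ ℚ.*-assoc q r r⁻¹ ⟩
  q ℚ.* (r ℚ.* r⁻¹)      ≡⟨ cong (q ℚ.*_) (ℚ.*-inverseʳ r) ⟩
  q ℚ.* 1ℚ               ≡⟨ ℚ.*-identityʳ q ⟩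
  q                      ∎
  where
  open ≡-Reasoning
  instance _ = ℚ.≢-nonZero r≢0
  r⁻¹ : ℚ
  r⁻¹ = ℚ.1/ r

-- Classes of a decidable equivalence relation

first : (Fin n → Bool) → Maybe (Fin n)
first {zero}  Q = nothing
first {suc n} Q = if Q zero then just zero else Maybe.map suc (first (Q ∘ suc))

first-cong : (P Q : Fin n → Bool) → T ∘ P ⊆ T ∘ Q → T ∘ Q ⊆ T ∘ P → first P ≡ first Q
first-cong {zero}  P Q P⊆Q Q⊆P = refl
first-cong {suc n} P Q P⊆Q Q⊆P with P zero in eP | Q zero in eQ
... | true  | true  = refl
... | false | false = cong (Maybe.map suc) (first-cong (P ∘ suc) (Q ∘ suc) P⊆Q Q⊆P)
... | true  | false = ⊥-elim (subst T eQ (P⊆Q (subst T (sym eP) _)))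
... | false | true  = ⊥-elim (subst T eP (Q⊆P (subst T (sym eQ) _)))

first-sound : (Q : Fin n → Bool) → Member Q → ∃[ z ] first Q ≡ just z × T (Q z)
first-sound {suc n} Q (w , qw) with Q zero in eQ | w
... | true  | _      = zero , refl , subst T (sym eQ) _
... | false | zero   = ⊥-elim (subst T eQ qw)
... | false | suc w′ with first-sound (Q ∘ suc) (w′ , qw)
...   | z , first≡z , qz = suc z , cong (Maybe.map suc) first≡z , qz

module Classes {ℓ : Level} (P : Fin n → Bool) {_≈_ : Rel (Fin n) ℓ} (_≈?_ : Decidable _≈_)
                (isEquivalence : IsEquivalence {A = Member P} (_≈_ on proj₁)) where

  private
    ≈-sym : ∀ {y y′} → T (P y) → T (P y′) → y ≈ y′ → y′ ≈ y
    ≈-sym {y} {y′} p p′ = IsEquivalence.sym isEquivalence {y , p} {y′ , p′}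

    ≈-trans : ∀ {y y′ y″} → T (P y) → T (P y′) → T (P y″) → y ≈ y′ → y′ ≈ y″ → y ≈ y″
    ≈-trans {y} {y′} {y″} p p′ p″ = IsEquivalence.trans isEquivalence {y , p} {y′ , p′} {y″ , p″}

  classmates : Fin n → Fin n → Bool
  classmates y z = P z ∧ does (z ≈? y)

  representative : Fin n → Fin n
  representative y = fromMaybe y (first (classmates y))

  self-classmate : ∀ {y} → T (P y) → Member (classmates y)
  self-classmate {y} p = y , Equivalence.from T-∧ (p , ⇒does (y ≈? y) (IsEquivalence.refl isEquivalence {y , p}))

  representative-classmate : ∀ {y} → T (P y) → T (P (representative y)) × representative y ≈ y
  representative-classmate {y} p with first-sound (classmates y) (self-classmate p)
  ... | z , first≡z , h rewrite first≡z with Equivalence.to T-∧ h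
  ...   | pz , z≈y = pz , does⇒ (z ≈? y) z≈y

  classmates-⊆ : ∀ {y y′} → T (P y) → T (P y′) → y ≈ y′ → T ∘ classmates y ⊆ T ∘ classmates y′
  classmates-⊆ {y} {y′} p p′ y≈y′ {z} h with Equivalence.to T-∧ h
  ... | pz , z≈y = Equivalence.from T-∧ (pz , ⇒does (z ≈? y′) (≈-trans pz p p′ (does⇒ (z ≈? y) z≈y) y≈y′))

  representative-cong : ∀ {y y′} → T (P y) → T (P y′) → y ≈ y′ → representative y ≡ representative y′
  representative-cong {y} {y′} p p′ y≈y′ with first-sound (classmates y) (self-classmate p)
  ... | z , first≡z , _ =
    trans (cong (fromMaybe y) first≡z) (cong (fromMaybe y′) (sym (trans (sym same-first) first≡z)))
    where
    same-first : first (classmates y) ≡ first (classmates y′)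
    same-first = first-cong (classmates y) (classmates y′)
                   (classmates-⊆ p p′ y≈y′) (classmates-⊆ p′ p (≈-sym p p′ y≈y′))

  isRepresentative : Fin n → Bool
  isRepresentative z = P z ∧ does (representative z ≟ z)

  representative-isRepresentative : ∀ {y} → T (P y) → T (isRepresentative (representative y))
  representative-isRepresentative {y} p with representative-classmate p
  ... | pr , r≈y = Equivalence.from T-∧
        (pr , ⇒does (representative (representative y) ≟ representative y) (representative-cong pr p r≈y))

  isRepresentative-P : ∀ {z} → T (isRepresentative z) → T (P z)
  isRepresentative-P rz = proj₁ (Equivalence.to T-∧ rz)

  representative-fixed : ∀ {z} → T (isRepresentative z) → representative z ≡ z
  representative-fixed {z} rz = does⇒ (representative z ≟ z) (proj₂ (Equivalence.to T-∧ rz))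

  #classes : ℕ
  #classes = count isRepresentative

  classIndex : Member P → Fin #classes
  classIndex (y , p) = Inverse.from (enumeration isRepresentative) (representative y , representative-isRepresentative p)

  classRep : Fin #classes → Fin n
  classRep i = proj₁ (Inverse.to (enumeration isRepresentative) i)

  classRep-isRepresentative : ∀ i → T (isRepresentative (classRep i))
  classRep-isRepresentative i = proj₂ (Inverse.to (enumeration isRepresentative) i)

  classRep-P : ∀ i → T (P (classRep i))
  classRep-P i = isRepresentative-P (classRep-isRepresentative i)

  classRep-classIndex : ∀ y → classRep (classIndex y) ≡ representative (proj₁ y)
  classRep-classIndex (y , p) = cong proj₁ (Inverse.strictlyInverseˡ (enumeration isRepresentative) _)

  ≈-classRep-classIndex : ∀ y → proj₁ y ≈ classRep (classIndex y)
  ≈-classRep-classIndex (y , p) = subst (y ≈_) (sym (classRep-classIndex (y , p)))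
    (≈-sym (proj₁ (representative-classmate p)) p (proj₂ (representative-classmate p)))

  classIndex-cong : ∀ {y y′} → proj₁ y ≈ proj₁ y′ → classIndex y ≡ classIndex y′
  classIndex-cong {y , p} {y′ , p′} y≈y′ =
    cong (Inverse.from (enumeration isRepresentative)) (Member-≡ (representative-cong p p′ y≈y′))

  classIndex-injective : ∀ {y y′} → classIndex y ≡ classIndex y′ → proj₁ y ≈ proj₁ y′
  classIndex-injective {y , p} {y′ , p′} same =
    ≈-trans p (classRep-P _) p′ (≈-classRep-classIndex (y , p))
      (subst (_≈ y′) (cong classRep (sym same)) (≈-sym p′ (classRep-P _) (≈-classRep-classIndex (y′ , p′))))

  classIndex-classRep : ∀ {y} i → proj₁ y ≈ classRep i → classIndex y ≡ i
  classIndex-classRep {y , p} i y≈rep = trans (classIndex-cong {y , p} {classRep i , classRep-P i} y≈rep)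
    (trans (cong (Inverse.from (enumeration isRepresentative))
                 (Member-≡ (representative-fixed (classRep-isRepresentative i))))
           (Inverse.strictlyInverseʳ (enumeration isRepresentative) i))

  single-class : (∀ (y y′ : Member P) → proj₁ y ≈ proj₁ y′) → Member P → #classes ≡ 1
  single-class total (y , p) =
    ↔⇒≡ (↔-trans (enumeration isRepresentative) (mk↔ₛ′ (λ _ → zero) (λ _ → r) (λ { zero → refl }) unique))
    where
    r : Member isRepresentative
    r = representative y , representative-isRepresentative p
    unique : ∀ z → r ≡ z
    unique (z , rz) = Member-≡ (trans (representative-cong p pz (total (y , p) (z , pz))) (representative-fixed rz))
      where
      pz : T (P z)
      pz = isRepresentative-P rz

-- Grids of two equivalence relations

module GridDecomposition {n : ℕ} {ℓ₁ ℓ₂ : Level} (P : Fin n → Bool)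
  {_∼ʳ_ : Rel (Fin n) ℓ₁} (_∼ʳ?_ : Decidable _∼ʳ_) (isEquivalenceʳ : IsEquivalence {A = Member P} (_∼ʳ_ on proj₁))
  {_∼ᶜ_ : Rel (Fin n) ℓ₂} (_∼ᶜ?_ : Decidable _∼ᶜ_) (isEquivalenceᶜ : IsEquivalence {A = Member P} (_∼ᶜ_ on proj₁))
  (q : ℕ)
  (cell-size : ∀ {a b} → T (P a) → T (P b) → count (λ z → P z ∧ does (z ∼ʳ? a) ∧ does (z ∼ᶜ? b)) ≡ q)
  where

  module Rows    = Classes P _∼ʳ?_ isEquivalenceʳ
  module Columns = Classes P _∼ᶜ?_ isEquivalenceᶜ

  cell : Fin Columns.#classes → Fin Rows.#classes → Fin n → Bool
  cell c ρ z = P z ∧ does (z ∼ʳ? Rows.classRep ρ) ∧ does (z ∼ᶜ? Columns.classRep c)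

  cellEnumeration : ∀ c ρ → Fin q ↔ Member (cell c ρ)
  cellEnumeration c ρ = subst (λ N → Fin N ↔ Member (cell c ρ))
    (cell-size (Rows.classRep-P ρ) (Columns.classRep-P c)) (enumeration (cell c ρ))

  position : ∀ c ρ → Member (cell c ρ) → Fin q
  position c ρ = Inverse.from (cellEnumeration c ρ)

  position-cong : ∀ {c c′ ρ ρ′ z} → c ≡ c′ → ρ ≡ ρ′ → (h : T (cell c ρ z)) (h′ : T (cell c′ ρ′ z)) →
                  position c ρ (z , h) ≡ position c′ ρ′ (z , h′)
  position-cong refl refl h h′ = cong (position _ _) (Member-≡ refl)

  in-own-cell : (y : Member P) → T (cell (Columns.classIndex y) (Rows.classIndex y) (proj₁ y))
  in-own-cell y@(y₀ , p) = Equivalence.from T-∧ (p , Equivalence.from T-∧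
    ( ⇒does (y₀ ∼ʳ? _) (Rows.≈-classRep-classIndex y)
    , ⇒does (y₀ ∼ᶜ? _) (Columns.≈-classRep-classIndex y)))

  toGrid : Member P → (Fin Columns.#classes × Fin Rows.#classes) × Fin q
  toGrid y = (Columns.classIndex y , Rows.classIndex y) , position _ _ (proj₁ y , in-own-cell y)

  cell-member : ∀ {c ρ} (z : Member (cell c ρ)) →
                T (P (proj₁ z)) × proj₁ z ∼ʳ Rows.classRep ρ × proj₁ z ∼ᶜ Columns.classRep c
  cell-member {c} {ρ} (z , h) with Equivalence.to (T-∧ {P z}) h
  ... | pz , h′ with Equivalence.to (T-∧ {does (z ∼ʳ? Rows.classRep ρ)}) h′
  ...   | z∼ʳρ , z∼ᶜc = pz , does⇒ (z ∼ʳ? _) z∼ʳρ , does⇒ (z ∼ᶜ? _) z∼ᶜc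

  fromGrid : (Fin Columns.#classes × Fin Rows.#classes) × Fin q → Member P
  fromGrid ((c , ρ) , i) = proj₁ z , proj₁ (cell-member z)
    where
    z : Member (cell c ρ)
    z = Inverse.to (cellEnumeration c ρ) i

  fromGrid∘toGrid : ∀ y → fromGrid (toGrid y) ≡ y
  fromGrid∘toGrid y = Member-≡ (cong proj₁ (Inverse.strictlyInverseˡ (cellEnumeration _ _) (proj₁ y , in-own-cell y)))

  toGrid∘fromGrid : ∀ g → toGrid (fromGrid g) ≡ g
  toGrid∘fromGrid ((c , ρ) , i) = cong₂ _,_ (cong₂ _,_ same-column same-row) same-position
    where
    z : Member (cell c ρ)
    z = Inverse.to (cellEnumeration c ρ) i
    same-column : Columns.classIndex (fromGrid ((c , ρ) , i)) ≡ c
    same-column = Columns.classIndex-classRep c (proj₂ (proj₂ (cell-member z)))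
    same-row : Rows.classIndex (fromGrid ((c , ρ) , i)) ≡ ρ
    same-row = Rows.classIndex-classRep ρ (proj₁ (proj₂ (cell-member z)))
    same-position : position _ _ (proj₁ z , in-own-cell (fromGrid ((c , ρ) , i))) ≡ i
    same-position = trans (position-cong same-column same-row (in-own-cell (fromGrid ((c , ρ) , i))) (proj₂ z))
                          (Inverse.strictlyInverseʳ (cellEnumeration c ρ) i)

  toGrid-injective : ∀ {y y′} → toGrid y ≡ toGrid y′ → y ≡ y′
  toGrid-injective {y} {y′} eq = trans (sym (fromGrid∘toGrid y)) (trans (cong fromGrid eq) (fromGrid∘toGrid y′))

  gridDecomposition : Member P ↔ ((Fin Columns.#classes × Fin Rows.#classes) × Fin q)
  gridDecomposition = mk↔ₛ′ toGrid fromGrid toGrid∘fromGrid fromGrid∘toGrid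

  count≡#columns*#rows*q : count P ≡ (Columns.#classes * Rows.#classes) * q
  count≡#columns*#rows*q = ↔⇒≡ (↔-trans (enumeration P) (↔-trans gridDecomposition
                         (↔-sym (↔-trans *↔× (*↔× ×-↔ ↔-refl)))))

module _ {m r q : ℕ} where

  private
    column : (Fin m × Fin r) × Fin q → Fin m
    column = proj₁ ∘ proj₁
    row : (Fin m × Fin r) × Fin q → Fin r
    row = proj₂ ∘ proj₁

  cliqueExt-grid-adj : ∀ {g g′} → g ≢ g′ → column g ≡ column g′ ⊎ row g ≡ row g′ →
                       Graph.Adj (CliqueExt q (Grid m r)) g g′
  cliqueExt-grid-adj {(c , ρ) , i} {(c′ , ρ′) , i′} g≢g′ same-line with c ≟ c′ | ρ ≟ ρ′
  ... | yes refl | yes refl = inj₁ (refl , λ { refl → g≢g′ refl })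
  ... | yes refl | no ρ≢ρ′  = inj₂ ((λ { refl → ρ≢ρ′ refl }) , inj₁ (refl , ρ≢ρ′))
  ... | no c≢c′  | yes refl = inj₂ ((λ { refl → c≢c′ refl }) , inj₂ (refl , c≢c′))
  ... | no c≢c′  | no ρ≢ρ′  = ⊥-elim ([ c≢c′ , ρ≢ρ′ ]′ same-line)

  cliqueExt-grid-adj⁻ : ∀ {g g′} → Graph.Adj (CliqueExt q (Grid m r)) g g′ →
                        g ≢ g′ × (column g ≡ column g′ ⊎ row g ≡ row g′)
  cliqueExt-grid-adj⁻ (inj₁ (refl , i≢i′))             = (λ { refl → i≢i′ refl }) , inj₁ refl
  cliqueExt-grid-adj⁻ (inj₂ (v≢v′ , inj₁ (refl , _))) = (λ { refl → v≢v′ refl }) , inj₁ refl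
  cliqueExt-grid-adj⁻ (inj₂ (v≢v′ , inj₂ (refl , _))) = (λ { refl → v≢v′ refl }) , inj₂ refl

anyF-sound : (p : Fin n → Bool) → T (anyF p) → ∃[ i ] T (p i)
anyF-sound {suc n} p h with Equivalence.to (T-∨ {p zero}) h
... | inj₁ p0 = zero , p0
... | inj₂ ps with anyF-sound (λ i → p (suc i)) ps
...   | i , pi = suc i , pi

anyF-complete : (p : Fin n → Bool) (i : Fin n) → T (p i) → T (anyF p)
anyF-complete p zero    pi = Equivalence.from T-∨ (inj₁ pi)
anyF-complete p (suc i) pi = Equivalence.from (T-∨ {p zero}) (inj₂ (anyF-complete (λ j → p (suc j)) i pi))

module _ (A : Fin n → Fin n → Bool) where

  within-closed : (S : Fin n → Set) → (∀ {w w′} → S w → T (A w w′) → S w′) →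
                  ∀ i {w z} → S w → T (within A i w z) → S z
  within-closed S closed zero    {w} Sw h = subst S (does⇒ (w ≟ _) h) Sw
  within-closed S closed (suc i) {w} {z} Sw h with Equivalence.to (T-∨ {within A i w z}) h
  ... | inj₁ short = within-closed S closed i Sw short
  ... | inj₂ step with anyF-sound (λ v → A w v ∧ within A i v z) step
  ...   | v , h′ with Equivalence.to T-∧ h′
  ...     | w~v , rest = within-closed S closed i (closed Sw w~v) rest

  within-suc : ∀ i {a b} → T (within A i a b) → T (within A (suc i) a b)
  within-suc i h = Equivalence.from T-∨ (inj₁ h)

  adjacent-or-equal⇒within : ∀ i {a b} → a ≡ b ⊎ T (A a b) → T (within A (suc i) a b)
  adjacent-or-equal⇒within zero {a} (inj₁ refl) = within-suc 0 (⇒does (a ≟ a) refl)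
  adjacent-or-equal⇒within zero {a} {b} (inj₂ a~b) =
    Equivalence.from (T-∨ {within A 0 a b}) (inj₂ (anyF-complete _ b (Equivalence.from T-∧ (a~b , ⇒does (b ≟ b) refl))))
  adjacent-or-equal⇒within (suc i) h = within-suc (suc i) (adjacent-or-equal⇒within i h)

  closed-clique-impossible : ∀ {D} → HasDiameter A D → D ≥ 2 →
    (S : Fin n → Set) → (∀ {w w′} → S w → T (A w w′) → S w′) →
    (∀ {a b} → S a → S b → a ≡ b ⊎ T (A a b)) → ∀ {x} → S x → ⊥
  closed-clique-impossible {suc (suc d)} (connected , x₁ , y₁ , diametral) (s≤s (s≤s _)) S closed clique {x} Sx
    with Equivalence.to T-∧ diametral
  ... | _ , far = subst T (Equivalence.to T-not-≡ far) (adjacent-or-equal⇒within d (clique (reach x₁) (reach y₁)))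
    where
    reach : ∀ z → S z
    reach z = within-closed S closed (suc (suc d)) Sx (connected x z)

-- Lines and assemblies

module GeometricGraph {n : ℕ} {A : Fin n → Fin n → Bool} {k : ℕ} {θ : ℚ} {𝒞 : Subset n → Set}
  (simple : IsSimpleGraph A) (geometric : IsGeometric A k θ 𝒞) where

  private variable
    a b c m p t u v w x y y′ z z′ : Fin n
    ℓ ℓ′ : Subset n

  infix 4 _~_
  _~_ : Fin n → Fin n → Set
  x ~ y = T (A x y)

  ~-sym : x ~ y → y ~ x
  ~-sym {x} {y} = subst T (IsSimpleGraph.symmetric simple x y)

  ~⇒≢ : x ~ y → x ≢ y
  ~⇒≢ {x} x~x refl = subst T (IsSimpleGraph.irreflexive simple x) x~x

  line-Delsarte : 𝒞 ℓ → IsDelsarte A k θ ℓ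
  line-Delsarte = proj₁ geometric _

  line-size : 𝒞 ℓ → ℕ→ℚ (∣ ℓ ∣ ∸ 1) ℚ.* (- θ) ≡ ℕ→ℚ k
  line-size ℓ∈𝒞 = proj₁ (proj₂ (line-Delsarte ℓ∈𝒞))

  lines-same-size : - θ ≢ 0ℚ → 𝒞 ℓ → 𝒞 ℓ′ → ∣ ℓ ∣ ∸ 1 ≡ ∣ ℓ′ ∣ ∸ 1
  lines-same-size θ≢0 ℓ∈𝒞 ℓ′∈𝒞 = ℕ→ℚ-injective (*-cancelʳ-≡ (- θ) θ≢0 (trans (line-size ℓ∈𝒞) (sym (line-size ℓ′∈𝒞))))

  line-clique : 𝒞 ℓ → a ∈ ℓ → b ∈ ℓ → a ≢ b → a ~ b
  line-clique ℓ∈𝒞 = proj₁ (line-Delsarte ℓ∈𝒞) _ _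

  lines-≡ : 𝒞 ℓ → 𝒞 ℓ′ → a ≢ b → a ∈ ℓ → b ∈ ℓ → a ∈ ℓ′ → b ∈ ℓ′ → ℓ ≡ ℓ′
  lines-≡ ℓ∈𝒞 ℓ′∈𝒞 a≢b aℓ bℓ aℓ′ bℓ′ =
    proj₂ (proj₂ geometric _ _ (line-clique ℓ∈𝒞 aℓ bℓ a≢b)) _ _ ℓ∈𝒞 aℓ bℓ ℓ′∈𝒞 aℓ′ bℓ′

  -- junk value ∅ when a and b are not adjacent
  line : Fin n → Fin n → Subset n
  line a b with T? (A a b)
  ... | yes a~b = proj₁ (proj₁ (proj₂ geometric a b a~b))
  ... | no  _   = ∅

  private
    line-spec : a ~ b → 𝒞 (line a b) × a ∈ line a b × b ∈ line a b
    line-spec {a} {b} a~b with T? (A a b)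
    ... | yes a~b′ = proj₂ (proj₁ (proj₂ geometric a b a~b′))
    ... | no ¬a~b  = contradiction a~b ¬a~b

  line-∈𝒞 : a ~ b → 𝒞 (line a b)
  line-∈𝒞 a~b = proj₁ (line-spec a~b)

  line-∋ˡ : a ~ b → a ∈ line a b
  line-∋ˡ a~b = proj₁ (proj₂ (line-spec a~b))

  line-∋ʳ : a ~ b → b ∈ line a b
  line-∋ʳ a~b = proj₂ (proj₂ (line-spec a~b))

  line-unique : a ~ b → 𝒞 ℓ → a ∈ ℓ → b ∈ ℓ → ℓ ≡ line a b
  line-unique a~b ℓ∈𝒞 aℓ bℓ = lines-≡ ℓ∈𝒞 (line-∈𝒞 a~b) (~⇒≢ a~b) aℓ bℓ (line-∋ˡ a~b) (line-∋ʳ a~b)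

  line-sym : a ~ b → line b a ≡ line a b
  line-sym a~b = line-unique a~b (line-∈𝒞 (~-sym a~b)) (line-∋ʳ (~-sym a~b)) (line-∋ˡ (~-sym a~b))

  line-adj : a ~ b → u ∈ line a b → v ∈ line a b → u ≢ v → u ~ v
  line-adj a~b = line-clique (line-∈𝒞 a~b)

  line-cong : x ~ y → x ~ y′ → y′ ∈ line x y → line x y ≡ line x y′
  line-cong x~y x~y′ y′∈ = line-unique x~y′ (line-∈𝒞 x~y) (line-∋ˡ x~y) y′∈

  module DualPaschGeometry (pasch : DualPasch A 𝒞) where

    pasch-adjacent : x ~ b → x ~ a → x ~ c → a ~ b → c ~ b →
                     a ∉ line x b → c ∉ line x b → a ≢ c → a ~ c
    pasch-adjacent x~b x~a x~c a~b c~b a∉xb c∉xb a≢c =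
      pasch _ _ _ x~b (line-∈𝒞 x~b) (line-∋ˡ x~b) (line-∋ʳ x~b) _ _
            x~a (~-sym a~b) x~c (~-sym c~b) a∉xb c∉xb a≢c

    pasch-quadrangle : x ~ y → x ~ z → y ~ z → z ∉ line x y →
                       y′ ∈ line x y → x ~ y′ → y′ ~ z →
                       z′ ∈ line x z → x ~ z′ → z′ ~ y → y′ ~ z′
    pasch-quadrangle {x} {y} {z} {y′} {z′} x~y x~z y~z z∉xy y′∈xy x~y′ y′~z z′∈xz x~z′ z′~y
      with y′ ≟ y | z′ ≟ z
    ... | yes refl | _        = ~-sym z′~y
    ... | no _     | yes refl = y′~z
    ... | no y′≢y  | no z′≢z  =
      pasch y z (line y z) y~z (line-∈𝒞 y~z) (line-∋ˡ y~z) (line-∋ʳ y~z) y′ z′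
            (line-adj x~y (line-∋ʳ x~y) y′∈xy (≢-sym y′≢y)) (~-sym y′~z)
            (~-sym z′~y) (line-adj x~z (line-∋ʳ x~z) z′∈xz (≢-sym z′≢z))
            y′∉yz z′∉yz y′≢z′
      where
      y′∉yz : y′ ∉ line y z
      y′∉yz y′∈yz = z∉xy (subst (z ∈_)
        (lines-≡ (line-∈𝒞 y~z) (line-∈𝒞 x~y) (≢-sym y′≢y) (line-∋ˡ y~z) y′∈yz (line-∋ʳ x~y) y′∈xy)
        (line-∋ʳ y~z))
      z′∉yz : z′ ∉ line y z
      z′∉yz z′∈yz = z∉xy (subst (z ∈_) (line-cong x~z x~y y∈xz) (line-∋ʳ x~z))
        where
        y∈xz : y ∈ line x z
        y∈xz = subst (y ∈_)
          (lines-≡ (line-∈𝒞 y~z) (line-∈𝒞 x~z) (≢-sym z′≢z) (line-∋ʳ y~z) z′∈yz (line-∋ʳ x~z) z′∈xz)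
          (line-∋ˡ y~z)
      y′≢z′ : y′ ≢ z′
      y′≢z′ refl = z∉xy (subst (z ∈_) (trans (line-cong x~z x~y′ z′∈xz) (sym (line-cong x~y x~y′ y′∈xy)))
                                       (line-∋ʳ x~z))

    module Assembly {M : Subset n} (assembly : IsAssembly A 𝒞 M) where

      private
        M-clique : a ∈ M → b ∈ M → a ≢ b → a ~ b
        M-clique a∈M b∈M = proj₁ (proj₁ assembly) _ _ a∈M b∈M

        M-maximal : v ∉ M → ¬ (∀ z → z ∈ M → v ~ z)
        M-maximal = proj₂ (proj₁ assembly) _

        ∉⇒≢ : a ∉ M → b ∈ M → a ≢ b
        ∉⇒≢ a∉M b∈M refl = a∉M b∈M

      assembly-⊈-line : 𝒞 ℓ → ∃[ p ] p ∈ M × p ∉ ℓ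
      assembly-⊈-line {ℓ} ℓ∈𝒞 with any? (λ p → (p ∈? M) ×-dec ¬? (p ∈? ℓ))
      ... | yes found = found
      ... | no none   = contradiction (subst 𝒞 (sym M≡ℓ) ℓ∈𝒞) (proj₂ assembly)
        where
        M⊆ℓ : ∀ {p} → p ∈ M → p ∈ ℓ
        M⊆ℓ {p} p∈M = decidable-stable (p ∈? ℓ) (λ p∉ℓ → none (p , p∈M , p∉ℓ))
        ℓ⊆M : ∀ {v} → v ∈ ℓ → v ∈ M
        ℓ⊆M {v} v∈ℓ = decidable-stable (v ∈? M) λ v∉M →
          M-maximal v∉M (λ z z∈M → line-clique ℓ∈𝒞 v∈ℓ (M⊆ℓ z∈M) (∉⇒≢ v∉M z∈M))
        M≡ℓ : M ≡ ℓ
        M≡ℓ = ⊆-antisym M⊆ℓ ℓ⊆M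

      module _ (x∈M : x ∈ M) (a∉M : a ∉ M) (x~a : x ~ a) (b∈M : b ∈ M) (a~b : a ~ b)
               (b≢x : b ≢ x) (b∉xa : b ∉ line x a) where

        private
          x~b : x ~ b
          x~b = M-clique x∈M b∈M (≢-sym b≢x)

          a∉xb : a ∉ line x b
          a∉xb a∈xb = b∉xa (subst (b ∈_) (line-cong x~b x~a a∈xb) (line-∋ʳ x~b))

          adjacent-off-line : m ∈ M → m ≢ x → m ∉ line x b → a ~ m
          adjacent-off-line m∈M m≢x m∉xb =
            pasch-adjacent x~b x~a (M-clique x∈M m∈M (≢-sym m≢x)) a~b
              (M-clique m∈M b∈M (λ { refl → m∉xb (line-∋ʳ x~b) })) a∉xb m∉xb (∉⇒≢ a∉M m∈M)

          adjacent-on-line : m ∈ M → m ≢ x → m ∈ line x b → p ∈ M → p ∉ line x b → a ~ m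
          adjacent-on-line {m} {p} m∈M m≢x m∈xb p∈M p∉xb = by-position (p ∈? line x a)
            where
            p≢x : p ≢ x
            p≢x refl = p∉xb (line-∋ˡ x~b)
            m≢p : m ≢ p
            m≢p refl = p∉xb m∈xb
            x~p : x ~ p
            x~p = M-clique x∈M p∈M (≢-sym p≢x)
            x~m : x ~ m
            x~m = M-clique x∈M m∈M (≢-sym m≢x)
            m~p : m ~ p
            m~p = M-clique m∈M p∈M m≢p

            by-position : Dec (p ∈ line x a) → a ~ m
            by-position (yes p∈xa) =
              ~-sym (pasch-quadrangle x~b x~p (M-clique b∈M p∈M b≢p) p∉xb m∈xb x~m m~p
                                      (subst (a ∈_) (line-cong x~a x~p p∈xa) (line-∋ʳ x~a)) x~a a~b)
              where
              b≢p : b ≢ p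
              b≢p refl = p∉xb (line-∋ʳ x~b)
            by-position (no p∉xa) =
              pasch-adjacent x~p x~a x~m (adjacent-off-line p∈M p≢x p∉xb) m~p a∉xp m∉xp (∉⇒≢ a∉M m∈M)
              where
              a∉xp : a ∉ line x p
              a∉xp a∈xp = p∉xa (subst (p ∈_) (line-cong x~p x~a a∈xp) (line-∋ʳ x~p))
              m∉xp : m ∉ line x p
              m∉xp m∈xp = p∉xb (subst (p ∈_) (trans (line-cong x~p x~m m∈xp) (sym (line-cong x~b x~m m∈xb)))
                                              (line-∋ʳ x~p))

        adjacent-to-assembly : m ∈ M → a ~ m
        adjacent-to-assembly {m} m∈M with m ≟ x | m ∈? line x a | m ∈? line x b | m ≟ b
        ... | yes refl | _        | _        | _        = ~-sym x~a
        ... | no m≢x   | yes m∈xa | _        | _        = line-adj x~a (line-∋ʳ x~a) m∈xa (∉⇒≢ a∉M m∈M)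
        ... | no m≢x   | no _     | no m∉xb  | _        = adjacent-off-line m∈M m≢x m∉xb
        ... | no m≢x   | no _     | yes _    | yes refl = a~b
        ... | no m≢x   | no _     | yes m∈xb | no _     with assembly-⊈-line (line-∈𝒞 x~b)
        ...   | p , p∈M , p∉xb = adjacent-on-line m∈M m≢x m∈xb p∈M p∉xb

      assembly-neighbours-collinear : x ∈ M → a ∉ M → x ~ a → b ∈ M → a ~ b → b ≢ x → b ∈ line x a
      assembly-neighbours-collinear x∈M a∉M x~a b∈M a~b b≢x = decidable-stable (_ ∈? _) λ b∉xa →
        M-maximal a∉M (λ _ → adjacent-to-assembly x∈M a∉M x~a b∈M a~b b≢x b∉xa)

      module _ (u∉M : u ∉ M) (z∈M : z ∈ M) (u~z : u ~ z) where

        assembly-neighbours-on-line : t ∈ M → u ~ t → t ∈ line u z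
        assembly-neighbours-on-line {t} t∈M u~t with t ≟ z
        ... | yes refl = line-∋ʳ u~z
        ... | no t≢z   = subst (t ∈_) (line-sym u~z)
                           (assembly-neighbours-collinear z∈M u∉M (~-sym u~z) t∈M u~t t≢z)

        line-to-assembly-unique : 𝒞 ℓ → u ∈ ℓ → ∃[ v ] v ∈ ℓ × v ∈ M → ℓ ≡ line u z
        line-to-assembly-unique ℓ∈𝒞 u∈ℓ (v , v∈ℓ , v∈M) =
          lines-≡ ℓ∈𝒞 (line-∈𝒞 u~z) u≢v u∈ℓ v∈ℓ (line-∋ˡ u~z)
                  (assembly-neighbours-on-line v∈M (line-clique ℓ∈𝒞 u∈ℓ v∈ℓ u≢v))
          where
          u≢v : u ≢ v
          u≢v = ∉⇒≢ u∉M v∈M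

      module _ {φ₁ : ℕ} (phi : IsPhi1 A k θ φ₁) where

        ∣line∩assembly∣≡φ₁ : 𝒞 ℓ → ∃[ v ] v ∈ ℓ × v ∈ M → ∣ ℓ ∩ M ∣ ≡ φ₁
        ∣line∩assembly∣≡φ₁ {ℓ} ℓ∈𝒞 (v , v∈ℓ , v∈M) with assembly-⊈-line ℓ∈𝒞
        ... | w , w∈M , w∉ℓ = begin
          ∣ ℓ ∩ M ∣                    ≡⟨ ∣∣≡count (ℓ ∩ M) ⟩
          count (λ t → mem t (ℓ ∩ M))  ≡⟨ count-cong (λ t → mem t (ℓ ∩ M)) (λ t → A w t ∧ mem t ℓ) ℓ∩M⊆N N⊆ℓ∩M ⟩
          nbrsIn A w ℓ                 ≡⟨ phi ℓ w (line-Delsarte ℓ∈𝒞) (w∉ℓ , v , v∈ℓ , w~v) ⟩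
          φ₁                           ∎
          where
          open ≡-Reasoning
          w~v : w ~ v
          w~v = M-clique w∈M v∈M (λ { refl → w∉ℓ v∈ℓ })
          ℓ∩M⊆N : ∀ {t} → T (mem t (ℓ ∩ M)) → T (A w t ∧ mem t ℓ)
          ℓ∩M⊆N {t} h with x∈p∩q⁻ ℓ M (does⇒ (t ∈? ℓ ∩ M) h)
          ... | t∈ℓ , t∈M = Equivalence.from T-∧ (M-clique w∈M t∈M (λ { refl → w∉ℓ t∈ℓ }) , ⇒does (t ∈? ℓ) t∈ℓ)
          N⊆ℓ∩M : ∀ {t} → T (A w t ∧ mem t ℓ) → T (mem t (ℓ ∩ M))
          N⊆ℓ∩M {t} h with Equivalence.to T-∧ h
          ... | w~t , t∈ℓ′ = ⇒does (t ∈? ℓ ∩ M) (x∈p∩q⁺ (t∈ℓ , decidable-stable (t ∈? M) t∉M⇒⊥))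
            where
            t∈ℓ : t ∈ ℓ
            t∈ℓ = does⇒ (t ∈? ℓ) t∈ℓ′
            t∉M⇒⊥ : t ∉ M → ⊥
            t∉M⇒⊥ t∉M = w∉ℓ (subst (w ∈_) (sym (line-unique v~t ℓ∈𝒞 v∈ℓ t∈ℓ))
              (assembly-neighbours-collinear v∈M t∉M v~t w∈M (~-sym w~t) (λ { refl → w∉ℓ v∈ℓ })))
              where
              v~t : v ~ t
              v~t = line-clique ℓ∈𝒞 v∈ℓ t∈ℓ (≢-sym (∉⇒≢ t∉M v∈M))

        nbrsIn-assembly≡φ₁ : u ∉ M → z ∈ M → u ~ z → nbrsIn A u M ≡ φ₁
        nbrsIn-assembly≡φ₁ {u} {z} u∉M z∈M u~z = begin
          nbrsIn A u M                        ≡⟨ count-cong (λ t → A u t ∧ mem t M) (λ t → mem t (line u z ∩ M))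
                                                            N⊆ℓ∩M ℓ∩M⊆N ⟩
          count (λ t → mem t (line u z ∩ M))  ≡⟨ sym (∣∣≡count (line u z ∩ M)) ⟩
          ∣ line u z ∩ M ∣                    ≡⟨ ∣line∩assembly∣≡φ₁ (line-∈𝒞 u~z) (z , line-∋ʳ u~z , z∈M) ⟩
          φ₁                                  ∎
          where
          open ≡-Reasoning
          N⊆ℓ∩M : ∀ {t} → T (A u t ∧ mem t M) → T (mem t (line u z ∩ M))
          N⊆ℓ∩M {t} h with Equivalence.to T-∧ h
          ... | u~t , t∈M′ = ⇒does (t ∈? _) (x∈p∩q⁺ (assembly-neighbours-on-line u∉M z∈M u~z t∈M u~t , t∈M))
            where
            t∈M : t ∈ M
            t∈M = does⇒ (t ∈? M) t∈M′
          ℓ∩M⊆N : ∀ {t} → T (mem t (line u z ∩ M)) → T (A u t ∧ mem t M)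
          ℓ∩M⊆N {t} h with x∈p∩q⁻ (line u z) M (does⇒ (t ∈? _) h)
          ... | t∈uz , t∈M =
            Equivalence.from T-∧ (line-adj u~z (line-∋ˡ u~z) t∈uz (∉⇒≢ u∉M t∈M) , ⇒does (t ∈? M) t∈M)

-- The local graph

module LocalStructure {n : ℕ} {A : Fin n → Fin n → Bool} {k : ℕ} {θ : ℚ} {𝒞 : Subset n → Set}
  (simple : IsSimpleGraph A) (geometric : IsGeometric A k θ 𝒞) (pasch : DualPasch A 𝒞) (x : Fin n) where

  open GeometricGraph {k = k} {θ = θ} simple geometric
  open DualPaschGeometry pasch

  private variable
    a b c t y y′ z z′ : Fin n

  infix 4 _∥_
  _∥_ : Fin n → Fin n → Set
  _∥_ = _≡_ on line x

  _∥?_ : Decidable _∥_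
  y ∥? y′ = ≡-dec Bool._≟_ (line x y) (line x y′)

  ∈⇒∥ : x ~ y → x ~ y′ → y′ ∈ line x y → y ∥ y′
  ∈⇒∥ = line-cong

  ∥⇒∈ : x ~ y′ → y ∥ y′ → y′ ∈ line x y
  ∥⇒∈ x~y′ y∥y′ = subst (_ ∈_) (sym y∥y′) (line-∋ʳ x~y′)

  ∦⇒∉ : x ~ y → x ~ y′ → ¬ y ∥ y′ → y′ ∉ line x y
  ∦⇒∉ x~y x~y′ y∦y′ y′∈ = y∦y′ (∈⇒∥ x~y x~y′ y′∈)

  ∥⇒~ : x ~ y → x ~ y′ → y ∥ y′ → y ≢ y′ → y ~ y′
  ∥⇒~ x~y x~y′ y∥y′ = line-adj x~y (line-∋ʳ x~y) (∥⇒∈ x~y′ y∥y′)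

  pasch-adjacentˣ : x ~ a → x ~ b → x ~ c → a ~ b → c ~ b → ¬ b ∥ a → ¬ b ∥ c → a ≢ c → a ~ c
  pasch-adjacentˣ x~a x~b x~c a~b c~b b∦a b∦c =
    pasch-adjacent x~b x~a x~c a~b c~b (∦⇒∉ x~b x~a b∦a) (∦⇒∉ x~b x~c b∦c)

  pasch-quadrangleˣ : x ~ y → x ~ z → y ~ z → ¬ y ∥ z →
                      y ∥ y′ → x ~ y′ → y′ ~ z → z ∥ z′ → x ~ z′ → z′ ~ y → y′ ~ z′
  pasch-quadrangleˣ x~y x~z y~z y∦z y∥y′ x~y′ y′~z z∥z′ x~z′ z′~y =
    pasch-quadrangle x~y x~z y~z (∦⇒∉ x~y x~z y∦z) (∥⇒∈ x~y′ y∥y′) x~y′ y′~z (∥⇒∈ x~z′ z∥z′) x~z′ z′~y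

  CommonNeighbourOffRow : Fin n → Fin n → Set
  CommonNeighbourOffRow y y′ = ∃[ t ] x ~ t × ¬ y ∥ t × t ~ y × t ~ y′

  -- In a clique-extended grid, two vertices in one row are in one column
  -- exactly when they have a common neighbour in another row.
  SameColumn : Fin n → Fin n → Set
  SameColumn y y′ = y ≡ y′ ⊎ (¬ y ∥ y′ × y ~ y′) ⊎ (y ∥ y′ × CommonNeighbourOffRow y y′)

  SameColumn? : Decidable SameColumn
  SameColumn? y y′ = (y ≟ y′) ⊎-dec ((¬? (y ∥? y′) ×-dec T? (A y y′)) ⊎-dec ((y ∥? y′) ×-dec
    any? (λ t → T? (A x t) ×-dec ¬? (y ∥? t) ×-dec T? (A t y) ×-dec T? (A t y′))))

  SameColumn-sym : SameColumn y y′ → SameColumn y′ y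
  SameColumn-sym (inj₁ refl)                               = inj₁ refl
  SameColumn-sym (inj₂ (inj₁ (y∦y′ , y~y′)))               = inj₂ (inj₁ (y∦y′ ∘′ sym , ~-sym y~y′))
  SameColumn-sym (inj₂ (inj₂ (y∥y′ , t , x~t , y∦t , t~y , t~y′))) =
    inj₂ (inj₂ (sym y∥y′ , t , x~t , y∦t ∘′ trans y∥y′ , t~y′ , t~y))

  SameColumn-∦⇒~ : SameColumn b c → ¬ b ∥ c → b ~ c
  SameColumn-∦⇒~ (inj₁ refl)                b∦c = contradiction refl b∦c
  SameColumn-∦⇒~ (inj₂ (inj₁ (_ , b~c)))    b∦c = b~c
  SameColumn-∦⇒~ (inj₂ (inj₂ (b∥c , _)))    b∦c = contradiction b∥c b∦c

  ~-respʳ-SameColumn : x ~ a → x ~ b → x ~ c → a ~ b → ¬ a ∥ b → SameColumn b c → ¬ a ∥ c → a ~ c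
  ~-respʳ-SameColumn x~a x~b x~c a~b a∦b (inj₁ refl) a∦c = a~b
  ~-respʳ-SameColumn x~a x~b x~c a~b a∦b (inj₂ (inj₁ (b∦c , b~c))) a∦c =
    pasch-adjacentˣ x~a x~b x~c a~b (~-sym b~c) (a∦b ∘′ sym) b∦c (λ { refl → a∦c refl })
  ~-respʳ-SameColumn {a} {b} {c} x~a x~b x~c a~b a∦b (inj₂ (inj₂ (b∥c , t , x~t , b∦t , t~b , t~c))) a∦c
    with t ≟ a | a ∥? t
  ... | yes refl | _       = t~c
  ... | no t≢a   | yes a∥t = ~-sym (pasch-quadrangleˣ x~b x~t (~-sym t~b) b∦t b∥c x~c (~-sym t~c) (sym a∥t) x~a a~b)
  ... | no t≢a   | no a∦t  =
    pasch-adjacentˣ x~a x~t x~c a~t (~-sym t~c) (a∦t ∘′ sym) (λ t∥c → b∦t (trans b∥c (sym t∥c)))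
                    (λ { refl → a∦c refl })
    where
    a~t : a ~ t
    a~t = pasch-adjacentˣ x~a x~b x~t a~b t~b (a∦b ∘′ sym) b∦t (≢-sym t≢a)

  SameColumn-trans : x ~ a → x ~ b → x ~ c → SameColumn a b → SameColumn b c → SameColumn a c
  SameColumn-trans x~a x~b x~c (inj₁ refl) b≡c = b≡c
  SameColumn-trans {a} {b} {c} x~a x~b x~c (inj₂ (inj₁ (a∦b , a~b))) b≡c with a ∥? c
  ... | yes a∥c = inj₂ (inj₂ (a∥c , b , x~b , a∦b , ~-sym a~b ,
                    SameColumn-∦⇒~ b≡c (λ b∥c → a∦b (trans a∥c (sym b∥c)))))
  ... | no a∦c  = inj₂ (inj₁ (a∦c , ~-respʳ-SameColumn x~a x~b x~c a~b a∦b b≡c a∦c))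
  SameColumn-trans {a} {b} {c} x~a x~b x~c a≡b@(inj₂ (inj₂ (a∥b , t , x~t , a∦t , t~a , t~b))) b≡c
    with a ∥? c
  ... | yes a∥c = inj₂ (inj₂ (a∥c , t , x~t , a∦t , t~a ,
                    ~-respʳ-SameColumn x~t x~b x~c t~b (λ t∥b → a∦t (trans a∥b (sym t∥b))) b≡c
                                 (λ t∥c → a∦t (trans a∥c (sym t∥c)))))
  ... | no a∦c  = inj₂ (inj₁ (a∦c , ~-sym c~a))
    where
    c~b : c ~ b
    c~b = ~-sym (SameColumn-∦⇒~ b≡c (λ b∥c → a∦c (trans a∥b b∥c)))
    c~a : c ~ a
    c~a = ~-respʳ-SameColumn x~c x~b x~a c~b (λ c∥b → a∦c (trans a∥b (sym c∥b))) (SameColumn-sym a≡b)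
                       (λ c∥a → a∦c (sym c∥a))

  SameColumn⇒~ : x ~ y → x ~ y′ → y ≢ y′ → SameColumn y y′ → y ~ y′
  SameColumn⇒~ x~y x~y′ y≢y′ (inj₁ y≡y′)                 = contradiction y≡y′ y≢y′
  SameColumn⇒~ x~y x~y′ y≢y′ (inj₂ (inj₁ (_ , y~y′)))    = y~y′
  SameColumn⇒~ x~y x~y′ y≢y′ (inj₂ (inj₂ (y∥y′ , _)))    = ∥⇒~ x~y x~y′ y∥y′ y≢y′

  ∥-isEquivalence : IsEquivalence {A = Member (A x)} (_∥_ on proj₁)
  ∥-isEquivalence = record { refl = refl ; sym = sym ; trans = trans }

  SameColumn-isEquivalence : IsEquivalence {A = Member (A x)} (SameColumn on proj₁)
  SameColumn-isEquivalence = record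
    { refl  = inj₁ refl
    ; sym   = SameColumn-sym
    ; trans = λ {a} {b} {c} → SameColumn-trans (proj₂ a) (proj₂ b) (proj₂ c)
    }

module LocalGraph {n : ℕ} {A : Fin n → Fin n → Bool} {k D φ₁ : ℕ} {θ : ℚ} {𝒞 : Subset n → Set}
  (simple : IsSimpleGraph A) (geometric : IsGeometric A k θ 𝒞) (pasch : DualPasch A 𝒞)
  (diameter : HasDiameter A D) (D≥2 : D ≥ 2) (regular : ∀ v → degree A v ≡ k)
  (phi : IsPhi1 A k θ φ₁) (φ₁≥2 : φ₁ ≥ 2) (x : Fin n) where

  open GeometricGraph {k = k} {θ = θ} simple geometric
  open LocalStructure {k = k} {θ = θ} simple geometric pasch x

  private variable
    a b : Fin n

  has-neighbour : ∃[ y ] x ~ y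
  has-neighbour with any? (λ y → T? (A x y))
  ... | yes found = found
  ... | no none   = ⊥-elim (closed-clique-impossible A diameter D≥2 (_≡ x) closed (λ { refl refl → inj₁ refl }) refl)
    where
    closed : ∀ {w w′} → w ≡ x → w ~ w′ → w′ ≡ x
    closed refl x~w′ = contradiction (_ , x~w′) none

  another-row : x ~ b → ∃[ w ] x ~ w × ¬ b ∥ w
  another-row {b} x~b with any? (λ w → T? (A x w) ×-dec ¬? (b ∥? w))
  ... | yes found = found
  ... | no none   = ⊥-elim (closed-clique-impossible A diameter D≥2 (_∈ ℓ) closed clique (line-∋ˡ x~b))
    where
    ℓ : Subset n
    ℓ = line x b
    onℓ : Fin n → Bool
    onℓ z = mem z ℓ
    others : Fin n → Fin n → Bool
    others y = onℓ ∖ y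
    row-full : ∀ {w} → x ~ w → w ∈ ℓ
    row-full {w} x~w = ∥⇒∈ x~w (decidable-stable (b ∥? w) (λ b∦w → none (w , x~w , b∦w)))
    #others : ∀ {y} → y ∈ ℓ → count (others y) ≡ count (others x)
    #others {y} y∈ℓ = suc-injective (trans (sym (count-remove onℓ y (⇒does (y ∈? ℓ) y∈ℓ)))
                                           (count-remove onℓ x (⇒does (x ∈? ℓ) (line-∋ˡ x~b))))
    closed : ∀ {w w′} → w ∈ ℓ → w ~ w′ → w′ ∈ ℓ
    closed {w} {w′} w∈ℓ w~w′ =
      does⇒ (w′ ∈? ℓ) (∖-⊆ onℓ w {w′} (⊆∧count≥⇒⊇ (others w) (A w) others⊆nbrs nbrs≤others w~w′))
      where
      others⊆nbrs : ∀ {z} → T (others w z) → w ~ z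
      others⊆nbrs {z} h =
        line-clique (line-∈𝒞 x~b) w∈ℓ (does⇒ (z ∈? ℓ) (∖-⊆ onℓ w {z} h)) (≢-sym (∖-≢ onℓ w {z} h))
      nbrs≤others : count (A w) ≤ count (others w)
      nbrs≤others = begin
        count (A w)      ≡⟨ trans (regular w) (sym (regular x)) ⟩
        count (A x)      ≤⟨ count-mono (A x) (others x) nbrs⊆others ⟩
        count (others x) ≡⟨ sym (#others w∈ℓ) ⟩
        count (others w) ∎
        where
        open ≤-Reasoning
        nbrs⊆others : ∀ {z} → x ~ z → T (others x z)
        nbrs⊆others {z} x~z = ∖-intro onℓ x (≢-sym (~⇒≢ x~z)) (⇒does (z ∈? ℓ) (row-full x~z))
    clique : ∀ {a c} → a ∈ ℓ → c ∈ ℓ → a ≡ c ⊎ a ~ c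
    clique {a} {c} a∈ℓ c∈ℓ with a ≟ c
    ... | yes a≡c = inj₁ a≡c
    ... | no a≢c  = inj₂ (line-clique (line-∈𝒞 x~b) a∈ℓ c∈ℓ a≢c)

  module _ {v : Fin n} (x~a : x ~ a) (x~v : x ~ v) (a∦v : ¬ a ∥ v) where

    neighbours-on-row : Fin n → Bool
    neighbours-on-row z = A v z ∧ mem z (line x a)

    #neighbours-on-row∖x : count (neighbours-on-row ∖ x) ≡ φ₁ ∸ 1
    #neighbours-on-row∖x = begin
      count (neighbours-on-row ∖ x)  ≡⟨ count-∖ neighbours-on-row x x-on-row ⟩
      count neighbours-on-row ∸ 1    ≡⟨ cong (_∸ 1) (phi (line x a) v (line-Delsarte (line-∈𝒞 x~a)) v-near-row) ⟩
      φ₁ ∸ 1                         ∎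
      where
      open ≡-Reasoning
      x-on-row : T (neighbours-on-row x)
      x-on-row = Equivalence.from T-∧ (~-sym x~v , ⇒does (x ∈? _) (line-∋ˡ x~a))
      v-near-row : AtDist1 A v (line x a)
      v-near-row = ∦⇒∉ x~a x~v a∦v , x , line-∋ˡ x~a , ~-sym x~v

    cell-size-via : ∀ {b} → (∀ {z} → x ~ z → z ∥ a → SameColumn z b → v ~ z) →
                    (∀ {z} → x ~ z → z ∥ a → v ~ z → SameColumn z b) →
                    count (λ z → A x z ∧ does (z ∥? a) ∧ does (SameColumn? z b)) ≡ φ₁ ∸ 1
    cell-size-via {b} to-v from-v = trans (count-cong _ (neighbours-on-row ∖ x) cell⊆ ⊆cell) #neighbours-on-row∖x
      where
      cell⊆ : ∀ {z} → T (A x z ∧ does (z ∥? a) ∧ does (SameColumn? z b)) → T ((neighbours-on-row ∖ x) z)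
      cell⊆ {z} h with Equivalence.to T-∧ h
      ... | x~z , h′ with Equivalence.to T-∧ h′
      ...   | z∥a , z≡b = ∖-intro neighbours-on-row x (≢-sym (~⇒≢ x~z)) (Equivalence.from T-∧
                (to-v x~z z∥a′ (does⇒ (SameColumn? z b) z≡b) , ⇒does (z ∈? _) (∥⇒∈ x~z (sym z∥a′))))
        where
        z∥a′ : z ∥ a
        z∥a′ = does⇒ (z ∥? a) z∥a
      ⊆cell : ∀ {z} → T ((neighbours-on-row ∖ x) z) → T (A x z ∧ does (z ∥? a) ∧ does (SameColumn? z b))
      ⊆cell {z} h with Equivalence.to T-∧ (∖-⊆ neighbours-on-row x h)
      ... | v~z , z∈xa′ = Equivalence.from T-∧ (x~z , Equivalence.from T-∧
              (⇒does (z ∥? a) z∥a , ⇒does (SameColumn? z b) (from-v x~z z∥a v~z)))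
        where
        z∈xa : z ∈ line x a
        z∈xa = does⇒ (z ∈? _) z∈xa′
        x~z : x ~ z
        x~z = line-adj x~a (line-∋ˡ x~a) z∈xa (≢-sym (∖-≢ neighbours-on-row x h))
        z∥a : z ∥ a
        z∥a = sym (∈⇒∥ x~a x~z z∈xa)

  off-row-neighbour : x ~ b → ∃[ t ] x ~ t × ¬ b ∥ t × b ~ t
  off-row-neighbour {b} x~b with another-row x~b
  ... | w , x~w , b∦w with count>0⇒Member (neighbours-on-row x~w x~b w∦b ∖ x)
                             (subst (0 <_) (sym (#neighbours-on-row∖x x~w x~b w∦b)) (m<n⇒0<n∸m φ₁≥2))
    where
    w∦b : ¬ w ∥ b
    w∦b = b∦w ∘′ sym
  ...   | t , h with Equivalence.to T-∧ (∖-⊆ (neighbours-on-row x~w x~b (b∦w ∘′ sym)) x h)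
  ...     | b~t , t∈xw′ = t , x~t , (λ b∥t → b∦w (trans b∥t (sym (∈⇒∥ x~w x~t t∈xw)))) , b~t
    where
    t∈xw : t ∈ line x w
    t∈xw = does⇒ (t ∈? _) t∈xw′
    x~t : x ~ t
    x~t = line-adj x~w (line-∋ˡ x~w) t∈xw (≢-sym (∖-≢ (neighbours-on-row x~w x~b (b∦w ∘′ sym)) x h))

  cell-size : x ~ a → x ~ b → count (λ z → A x z ∧ does (z ∥? a) ∧ does (SameColumn? z b)) ≡ φ₁ ∸ 1
  cell-size {a} {b} x~a x~b with a ∥? b
  ... | no a∦b = cell-size-via x~a x~b a∦b
        (λ x~z z∥a z≡b → ~-sym (SameColumn-∦⇒~ z≡b (λ z∥b → a∦b (trans (sym z∥a) z∥b))))
        (λ x~z z∥a b~z → inj₂ (inj₁ ((λ z∥b → a∦b (trans (sym z∥a) z∥b)) , ~-sym b~z)))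
  ... | yes a∥b with off-row-neighbour x~b
  ...   | t , x~t , b∦t , b~t = cell-size-via x~a x~t (λ a∥t → b∦t (trans (sym a∥b) a∥t))
          (λ {z} x~z z∥a z≡b → ~-respʳ-SameColumn x~t x~b x~z (~-sym b~t) (b∦t ∘′ sym) (SameColumn-sym z≡b)
                                  (λ t∥z → b∦t (trans (sym a∥b) (trans (sym z∥a) (sym t∥z)))))
          (λ {z} x~z z∥a t~z → SameColumn-trans x~z x~t x~b
                                  (inj₂ (inj₁ ((λ z∥t → b∦t (trans (sym a∥b) (trans (sym z∥a) z∥t))) , ~-sym t~z)))
                                  (inj₂ (inj₁ (b∦t ∘′ sym , ~-sym b~t))))

  module LocalGrid = GridDecomposition (A x) _∥?_ ∥-isEquivalence SameColumn? SameColumn-isEquivalence (φ₁ ∸ 1) cell-size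

  open LocalGrid using (toGrid; fromGrid; module Rows; module Columns)

  #columns #rows : ℕ
  #columns = Columns.#classes
  #rows    = Rows.#classes
  same-row-or-column : ∀ (y y′ : Member (A x)) → proj₁ y ~ proj₁ y′ →
    Columns.classIndex y ≡ Columns.classIndex y′ ⊎ Rows.classIndex y ≡ Rows.classIndex y′
  same-row-or-column y y′ y~y′ = by-row (proj₁ y ∥? proj₁ y′)
    where
    by-row : Dec (proj₁ y ∥ proj₁ y′) →
             Columns.classIndex y ≡ Columns.classIndex y′ ⊎ Rows.classIndex y ≡ Rows.classIndex y′
    by-row (yes y∥y′) = inj₂ (Rows.classIndex-cong {y} {y′} y∥y′)
    by-row (no y∦y′)  = inj₁ (Columns.classIndex-cong {y} {y′} (inj₂ (inj₁ (y∦y′ , y~y′))))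

  adj-to : ∀ y y′ → proj₁ y ~ proj₁ y′ →
           Graph.Adj (CliqueExt (φ₁ ∸ 1) (Grid #columns #rows)) (toGrid y) (toGrid y′)
  adj-to y y′ y~y′ =
    cliqueExt-grid-adj {m = #columns} {r = #rows} {q = φ₁ ∸ 1} {g = toGrid y} {g′ = toGrid y′}
      (λ eq → ~⇒≢ y~y′ (cong proj₁ (LocalGrid.toGrid-injective eq))) (same-row-or-column y y′ y~y′)

  adj-from : ∀ y y′ → Graph.Adj (CliqueExt (φ₁ ∸ 1) (Grid #columns #rows)) (toGrid y) (toGrid y′) →
             proj₁ y ~ proj₁ y′
  adj-from y@(_ , x~y) y′@(_ , x~y′) adj =
    [ (λ same-column → SameColumn⇒~ x~y x~y′ y≢y′ (Columns.classIndex-injective {y} {y′} same-column))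
    , (λ same-row → ∥⇒~ x~y x~y′ (Rows.classIndex-injective {y} {y′} same-row) y≢y′)
    ]′ (proj₂ grid-adj)
    where
    grid-adj : toGrid y ≢ toGrid y′ ×
               (Columns.classIndex y ≡ Columns.classIndex y′ ⊎ Rows.classIndex y ≡ Rows.classIndex y′)
    grid-adj = cliqueExt-grid-adj⁻ {m = #columns} {r = #rows} {q = φ₁ ∸ 1} {g = toGrid y} {g′ = toGrid y′} adj
    y≢y′ : proj₁ y ≢ proj₁ y′
    y≢y′ eq = proj₁ grid-adj (cong toGrid (Member-≡ eq))

  local≅cliqueExt-grid : Local A x ≅ CliqueExt (φ₁ ∸ 1) (Grid #columns #rows)
  local≅cliqueExt-grid = record
    { to       = toGrid
    ; from     = fromGrid
    ; from∘to  = LocalGrid.fromGrid∘toGrid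
    ; to∘from  = LocalGrid.toGrid∘fromGrid
    ; adj-to   = adj-to
    ; adj-from = adj-from
    }

  private
    y₀ : Fin n
    y₀ = proj₁ has-neighbour
    x~y₀ : x ~ y₀
    x~y₀ = proj₂ has-neighbour

  -- β = k / (-θ) of the paper: every line has β + 1 vertices
  β : ℕ
  β = ∣ line x y₀ ∣ ∸ 1

  -θ≢0 : - θ ≢ 0ℚ
  -θ≢0 θ≡0 = m<n⇒n≢0 (subst (0 <_) (regular x) (Member⇒count>0 (A x) has-neighbour)) k≡0
    where
    k≡0 : k ≡ 0
    k≡0 = ℕ→ℚ-injective (trans (sym (line-size (line-∈𝒞 x~y₀))) (trans (cong (ℕ→ℚ β ℚ.*_) θ≡0) (ℚ.*-zeroʳ (ℕ→ℚ β))))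

  row-size : x ~ a → count (λ z → A x z ∧ does (z ∥? a) ∧ true) ≡ β
  row-size {a} x~a = begin
    count (λ z → A x z ∧ does (z ∥? a) ∧ true) ≡⟨ count-cong _ (onRow ∖ x) row⊆ ⊆row ⟩
    count (onRow ∖ x)                          ≡⟨ count-∖ onRow x (⇒does (x ∈? line x a) (line-∋ˡ x~a)) ⟩
    count onRow ∸ 1                            ≡⟨ cong (_∸ 1) (sym (∣∣≡count (line x a))) ⟩
    ∣ line x a ∣ ∸ 1                           ≡⟨ lines-same-size -θ≢0 (line-∈𝒞 x~a) (line-∈𝒞 x~y₀) ⟩
    β                                          ∎
    where
    open ≡-Reasoning
    onRow : Fin n → Bool
    onRow z = mem z (line x a)
    row⊆ : ∀ {z} → T (A x z ∧ does (z ∥? a) ∧ true) → T ((onRow ∖ x) z)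
    row⊆ {z} h with Equivalence.to T-∧ h
    ... | x~z , h′ = ∖-intro onRow x (≢-sym (~⇒≢ x~z))
                       (⇒does (z ∈? _) (∥⇒∈ x~z (sym (does⇒ (z ∥? a) (proj₁ (Equivalence.to T-∧ h′))))))
    ⊆row : ∀ {z} → T ((onRow ∖ x) z) → T (A x z ∧ does (z ∥? a) ∧ true)
    ⊆row {z} h = Equivalence.from T-∧ (x~z , Equivalence.from T-∧ (⇒does (z ∥? a) (sym (∈⇒∥ x~a x~z z∈xa)) , _))
      where
      z∈xa : z ∈ line x a
      z∈xa = does⇒ (z ∈? _) (∖-⊆ onRow x {z} h)
      x~z : x ~ z
      x~z = line-adj x~a (line-∋ˡ x~a) z∈xa (≢-sym (∖-≢ onRow x h))

  Anywhere : Fin n → Fin n → Set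
  Anywhere _ _ = ⊤

  Anywhere-isEquivalence : IsEquivalence {A = Member (A x)} (Anywhere on proj₁)
  Anywhere-isEquivalence = record { refl = tt ; sym = λ _ → tt ; trans = λ _ _ → tt }

  -- with a single column, the grid decomposition just counts the rows
  module RowDecomposition = GridDecomposition (A x) _∥?_ ∥-isEquivalence {_∼ᶜ_ = Anywhere} (λ _ _ → yes tt)
                              Anywhere-isEquivalence β (λ x~a _ → row-size x~a)

  k≡#rows*β : k ≡ #rows * β
  k≡#rows*β = begin
    k                                                ≡⟨ sym (regular x) ⟩
    count (A x)                                      ≡⟨ RowDecomposition.count≡#columns*#rows*q ⟩
    (RowDecomposition.Columns.#classes * #rows) * β  ≡⟨ cong (λ c → (c * #rows) * β) one-column ⟩
    (1 * #rows) * β                                  ≡⟨ cong (_* β) (*-identityˡ #rows) ⟩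
    #rows * β                                        ∎
    where
    open ≡-Reasoning
    one-column : RowDecomposition.Columns.#classes ≡ 1
    one-column = RowDecomposition.Columns.single-class (λ _ _ → tt) has-neighbour

  k≡#columns*#rows*[φ₁-1] : k ≡ (#columns * #rows) * (φ₁ ∸ 1)
  k≡#columns*#rows*[φ₁-1] = trans (sym (regular x)) LocalGrid.count≡#columns*#rows*q

  #rows≡-θ : ℕ→ℚ #rows ≡ - θ
  #rows≡-θ = *-cancelʳ-≡ (ℕ→ℚ β) β≢0 (begin
    ℕ→ℚ #rows ℚ.* ℕ→ℚ β   ≡⟨ sym (ℕ→ℚ-* #rows β) ⟩
    ℕ→ℚ (#rows * β)       ≡⟨ cong ℕ→ℚ (sym k≡#rows*β) ⟩
    ℕ→ℚ k                 ≡⟨ sym (line-size (line-∈𝒞 x~y₀)) ⟩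
    ℕ→ℚ β ℚ.* (- θ)       ≡⟨ ℚ.*-comm (ℕ→ℚ β) (- θ) ⟩
    (- θ) ℚ.* ℕ→ℚ β       ∎)
    where
    open ≡-Reasoning
    β≢0 : ℕ→ℚ β ≢ 0ℚ
    β≢0 β≡0 = m<n⇒n≢0 (subst (0 <_) (row-size x~y₀) (Member⇒count>0 _ (y₀ , y₀-in-own-row))) (ℕ→ℚ-injective β≡0)
      where
      y₀-in-own-row : T (A x y₀ ∧ does (y₀ ∥? y₀) ∧ true)
      y₀-in-own-row = Equivalence.from T-∧ (x~y₀ , Equivalence.from T-∧ (⇒does (y₀ ∥? y₀) refl , _))

  grid-size : ℕ→ℚ (#columns * (φ₁ ∸ 1)) ℚ.* (- θ) ≡ ℕ→ℚ k
  grid-size = begin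
    ℕ→ℚ (#columns * (φ₁ ∸ 1)) ℚ.* (- θ)          ≡⟨ cong (ℕ→ℚ (#columns * (φ₁ ∸ 1)) ℚ.*_) (sym #rows≡-θ) ⟩
    ℕ→ℚ (#columns * (φ₁ ∸ 1)) ℚ.* ℕ→ℚ #rows      ≡⟨ sym (ℕ→ℚ-* (#columns * (φ₁ ∸ 1)) #rows) ⟩
    ℕ→ℚ ((#columns * (φ₁ ∸ 1)) * #rows)         ≡⟨ cong ℕ→ℚ (xy∙z≈xz∙y #columns (φ₁ ∸ 1) #rows) ⟩
    ℕ→ℚ ((#columns * #rows) * (φ₁ ∸ 1))         ≡⟨ cong ℕ→ℚ (sym k≡#columns*#rows*[φ₁-1]) ⟩
    ℕ→ℚ k                                       ∎
    where open ≡-Reasoning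

theorem35 :
    ∀ {n : ℕ} (A : Fin n → Fin n → Bool) (k D φ₁ : ℕ) (θ : ℚ)
      (𝒞 : Subset n → Set) →
    IsDRG A k D → D ≥ 3 →
    IsSmallestEigenvalue A θ →
    IsGeometric A k θ 𝒞 →
    IsPhi1 A k θ φ₁ → φ₁ ≥ 2 →
    DualPasch A 𝒞 →
    (∀ (ℓ M : Subset n) (u : Fin n) → 𝒞 ℓ → IsAssembly A 𝒞 M → u ∉ M →
        ((∃[ v ] (v ∈ ℓ × v ∈ M)) → ∣ ℓ ∩ M ∣ ≡ φ₁)
      × ((∃[ z ] (z ∈ M × T (A u z))) →
            (nbrsIn A u M ≡ φ₁)
          × (∃[ ℓ′ ] (𝒞 ℓ′ × u ∈ ℓ′ × (∃[ v ] (v ∈ ℓ′ × v ∈ M))))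
          × (∀ ℓ₁ ℓ₂ → 𝒞 ℓ₁ → u ∈ ℓ₁ → (∃[ v ] (v ∈ ℓ₁ × v ∈ M)) →
                       𝒞 ℓ₂ → u ∈ ℓ₂ → (∃[ v ] (v ∈ ℓ₂ × v ∈ M)) → ℓ₁ ≡ ℓ₂)))
    × (∀ (x : Fin n) →
         Σ ℕ λ m → Σ ℕ λ r →
             (ℕ→ℚ r ≡ - θ)
           × (ℕ→ℚ (m * (φ₁ ∸ 1)) Data.Rational.* (- θ) ≡ ℕ→ℚ k)
           × (Local A x ≅ CliqueExt (φ₁ ∸ 1) (Grid m r)))
theorem35 A k D φ₁ θ 𝒞 (simple , diameter , regular , _) D≥3 _ geometric phi φ₁≥2 pasch =
    (λ ℓ M u ℓ∈𝒞 assembly u∉M → let open Assembly assembly in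
        ∣line∩assembly∣≡φ₁ phi ℓ∈𝒞
      , λ (z , z∈M , u~z) →
            nbrsIn-assembly≡φ₁ phi u∉M z∈M u~z
          , (line u z , line-∈𝒞 u~z , line-∋ˡ u~z , z , line-∋ʳ u~z , z∈M)
          , λ ℓ₁ ℓ₂ ℓ₁∈𝒞 u∈ℓ₁ ℓ₁∩M ℓ₂∈𝒞 u∈ℓ₂ ℓ₂∩M →
              trans (line-to-assembly-unique u∉M z∈M u~z ℓ₁∈𝒞 u∈ℓ₁ ℓ₁∩M)
                    (sym (line-to-assembly-unique u∉M z∈M u~z ℓ₂∈𝒞 u∈ℓ₂ ℓ₂∩M)))
  , λ x → let open LocalGraph {k = k} {D = D} {θ = θ} simple geometric pasch diameter (<⇒≤ D≥3) regular phi φ₁≥2 x in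
          #columns , #rows , #rows≡-θ , grid-size , local≅cliqueExt-grid
  where
  open GeometricGraph {k = k} {θ = θ} simple geometric
  open DualPaschGeometry pasch
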